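{- Let $H$ be a reflexive triangle-free graph. Let $U_1$ be an $(s,a)$-walk, $X$ an $(a,b)$-walk, $V_1$ a $(b,s)$-walk, $U_2$ a $(t,b)$-walk and $V_2$ an $(a,t)$-walk in $H$, and set $C_1=U_1\cdot X\cdot V_1$ (closed, basepoint $s$), $C_2=U_2\cdot\overleftarrow{X}\cdot V_2$ (closed, basepoint $t$), and $C=C_1\cdot_X C_2:=U_1\cdot V_2\cdot U_2\cdot V_1$ (closed, basepoint $s$). If two of $[C_1],[C_2],[C]$ are contractible, then all three are.
   Context: A walk in $H$ is a sequence $(x_0,\dots,x_\ell)$ of vertices with $x_{i-1}x_i\in E(H)$ for all $i$ (consecutive vertices may be equal since $H$ is reflexive); it is an $(a,b)$-walk if $x_0=a,x_\ell=b$, closed with basepoint $a$ if $a=b$. Concatenation $X\cdot Y$ identifies the last vertex of $X$ with the first of $Y$; $\overleftarrow{X}$ is $X$ reversed. $\Pi(H;a,b)$ is the graph on $(a,b)$-walks where $X=(x_0,\dots,x_\ell)$ and $Y$ are adjacent if (P1) $Y=(x_0,\dots,x_i,x_i,\dots,x_\ell)$ for some $i$, or (P2) $Y=(x_0,\dots,x_{i-1},x_i',x_{i+1},\dots,x_\ell)$ for some $0<i<\ell$ with $x_i'\sim x_i$ and $Y$ a walk; adjacency is symmetric. $[X]$ is the component of $\Pi(H;a,b)$ containing $X$. A closed walk $D$ with basepoint $r$ is contractible if $[D]=[0]$, where $0=(r)$ is the trivial walk at $r$. -}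

module Defs where

open import Data.Nat using (ℕ)
open import Data.Fin using (Fin)
open import Data.Bool using (Bool; true)
open import Data.List using (List; []; _∷_; _++_; drop)
open import Data.Product using (_×_; Σ)
open import Data.Sum using (_⊎_)
open import Data.Empty using (⊥)
open import Relation.Binary.PropositionalEquality using (_≡_; _≢_)
open import Relation.Binary.Construct.Closure.ReflexiveTransitive using (Star)

record RGraph : Set where
  field
    n     : ℕ
    adj   : Fin n → Fin n → Bool
    symm  : ∀ x y → adj x y ≡ adj y x
    refl~ : ∀ x → adj x x ≡ true

module _ (H : RGraph) where
  open RGraph H

  V : Set
  V = Fin n

  _~_ : V → V → Set
  x ~ y = adj x y ≡ true

  TriangleFree : Set
  TriangleFree = ∀ x y z → x ≢ y → y ≢ z → x ≢ z →
                 x ~ y → y ~ z → x ~ z → ⊥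

  data IsWalk : V → V → List V → Set where
    one  : ∀ x → IsWalk x x (x ∷ [])
    step : ∀ {x y b l} → x ~ y → IsWalk y b l → IsWalk x b (x ∷ l)

  data Move : List V → List V → Set where
    P1 : ∀ p x q → Move (p ++ x ∷ q) (p ++ x ∷ x ∷ q)
    -- (P2) replace an interior vertex x_i (0 < i < ℓ) by a neighbour x'
    P2 : ∀ p₀ p x x' q₀ q → x' ~ x →
         Move ((p₀ ∷ p) ++ x ∷ q₀ ∷ q) ((p₀ ∷ p) ++ x' ∷ q₀ ∷ q)

  ΠAdj : V → V → List V → List V → Set
  ΠAdj a b X Y = IsWalk a b X × IsWalk a b Y × (Move X Y ⊎ Move Y X)

  -- same component of Π(H;a,b), i.e. [X] = [Y]
  SameComp : V → V → List V → List V → Set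
  SameComp a b = Star (ΠAdj a b)

  -- concatenation X · Y (last vertex of X identified with first of Y)
  _·_ : List V → List V → List V
  X · Y = X ++ drop 1 Y

  -- closed walk D with basepoint r is contractible: [D] = [(r)]
  Contractible : V → List V → Set
  Contractible r D = SameComp r r D (r ∷ [])

-- Walks modulo the moves P1/P2 form a groupoid: concatenation is associative with
-- the trivial walks as units, it respects [·] in each argument, and X · X⁻¹ contracts
-- onto its basepoint (a backtrack x y x becomes x x x by P2, then x by P1).
-- There, C₂ = U₂ X⁻¹ V₂ is contractible iff V₂ U₂ ∼ X, and since conjugation by
-- U₁, V₁ is invertible, C = U₁ (V₂ U₂) V₁ ∼ C₁ = U₁ X V₁ iff V₂ U₂ ∼ X as well.
-- So any two of the three statements give V₂ U₂ ∼ X, and hence the third.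
module Submission where

open import Defs
open import Data.List using (List; reverse; []; _∷_; _++_; drop; [_])
open import Data.List.Properties using (++-assoc; ++-identityʳ; unfold-reverse; reverse-involutive)
open import Data.Product using (_×_; _,_; ∃-syntax)
open import Data.Sum using (_⊎_; inj₁; inj₂; map)
open import Function.Bundles using (_⇔_; mk⇔; Equivalence)
open import Function.Properties.Equivalence using () renaming (trans to ⇔-trans)
open import Relation.Binary.PropositionalEquality using (_≡_; refl; sym; trans; cong; subst; subst₂; module ≡-Reasoning)
open import Relation.Binary.Construct.Closure.ReflexiveTransitive using (ε; _◅_; _◅◅_; gmap)
  renaming (reverse to Star-reverse)
open import Relation.Binary.Bundles using (Setoid)
import Relation.Binary.Reasoning.Setoid as SetoidReasoning

open Equivalence using (to; from)

module _ (H : RGraph) where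
  open RGraph H using (symm; refl~)

  private
    _∙_ : List (V H) → List (V H) → List (V H)
    _∙_ = _·_ H

    infixl 5 _∙_

  ~-sym : ∀ {x y} → _~_ H x y → _~_ H y x
  ~-sym {x} {y} x~y = trans (symm y x) x~y

  IsWalk-head : ∀ {a b X} → IsWalk H a b X → X ≡ a ∷ drop 1 X
  IsWalk-head (one x)    = refl
  IsWalk-head (step _ _) = refl

  IsWalk-init : ∀ {a b X} → IsWalk H a b X → ∃[ P ] X ≡ P ++ [ b ]
  IsWalk-init (one x) = [] , refl
  IsWalk-init (step {x} _ w) with IsWalk-init w
  ... | P , eq = x ∷ P , cong (x ∷_) eq

  IsWalk-∙ : ∀ {a b c X Y} → IsWalk H a b X → IsWalk H b c Y → IsWalk H a c (X ∙ Y)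
  IsWalk-∙ (one x)    (one .x)   = one x
  IsWalk-∙ (one x)    (step e w) = step e w
  IsWalk-∙ (step e w) w'         = step e (IsWalk-∙ w w')

  IsWalk-snoc : ∀ {a b c X} → IsWalk H a b X → _~_ H b c → IsWalk H a c (X ++ [ c ])
  IsWalk-snoc (one x)    e = step e (one _)
  IsWalk-snoc (step d w) e = step d (IsWalk-snoc w e)

  IsWalk-reverse : ∀ {a b X} → IsWalk H a b X → IsWalk H b a (reverse X)
  IsWalk-reverse (one x) = one x
  IsWalk-reverse (step {x} {l = l} e w) rewrite unfold-reverse x l =
    IsWalk-snoc (IsWalk-reverse w) (~-sym e)

  drop1-++ : ∀ {a b X} → IsWalk H a b X → ∀ R → drop 1 (X ++ R) ≡ drop 1 X ++ R
  drop1-++ (one x)    R = refl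
  drop1-++ (step _ _) R = refl

  ∙-assoc : ∀ {a b Y} → IsWalk H a b Y → ∀ X Z → X ∙ Y ∙ Z ≡ X ∙ (Y ∙ Z)
  ∙-assoc (one y)            X Z = ++-assoc X [] (drop 1 Z)
  ∙-assoc (step {l = l} _ _) X Z = ++-assoc X l (drop 1 Z)

  ∙-identityˡ : ∀ {a b X} → IsWalk H a b X → [ a ] ∙ X ≡ X
  ∙-identityˡ (one x)    = refl
  ∙-identityˡ (step _ _) = refl

  ∙-identityʳ : ∀ X {b} → X ∙ [ b ] ≡ X
  ∙-identityʳ X = ++-identityʳ X

  Move-++ʳ : ∀ {X Y} → Move H X Y → ∀ R → Move H (X ++ R) (Y ++ R)
  Move-++ʳ (P1 p x q) R
    rewrite ++-assoc p (x ∷ q) R | ++-assoc p (x ∷ x ∷ q) R = P1 p x (q ++ R)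
  Move-++ʳ (P2 p₀ p x x' q₀ q e) R
    rewrite ++-assoc p (x ∷ q₀ ∷ q) R | ++-assoc p (x' ∷ q₀ ∷ q) R = P2 p₀ p x x' q₀ (q ++ R) e

  Move-++ˡ : ∀ {X Y} → Move H X Y → ∀ P → Move H (P ++ X) (P ++ Y)
  Move-++ˡ (P1 p x q) P
    rewrite sym (++-assoc P p (x ∷ q)) | sym (++-assoc P p (x ∷ x ∷ q)) = P1 (P ++ p) x q
  Move-++ˡ m [] = m
  Move-++ˡ (P2 p₀ p x x' q₀ q e) (y ∷ P)
    rewrite sym (++-assoc P (p₀ ∷ p) (x ∷ q₀ ∷ q)) | sym (++-assoc P (p₀ ∷ p) (x' ∷ q₀ ∷ q)) =
    P2 y (P ++ p₀ ∷ p) x x' q₀ q e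

  SameComp-sym : ∀ {a b X Y} → SameComp H a b X Y → SameComp H a b Y X
  SameComp-sym = Star-reverse λ where
    (wX , wY , inj₁ m) → wY , wX , inj₂ m
    (wX , wY , inj₂ m) → wY , wX , inj₁ m

  Π-setoid : V H → V H → Setoid _ _
  Π-setoid a b = record
    { Carrier       = List (V H)
    ; _≈_           = SameComp H a b
    ; isEquivalence = record { refl = ε ; sym = SameComp-sym ; trans = _◅◅_ }
    }

  ∙-congʳ : ∀ {a b c X X' R} → SameComp H a b X X' → IsWalk H b c R →
            SameComp H a c (X ∙ R) (X' ∙ R)
  ∙-congʳ {R = R} X∼X' wR = gmap (_∙ R) adj X∼X'
    where
    adj : ∀ {X Y} → ΠAdj H _ _ X Y → ΠAdj H _ _ (X ∙ R) (Y ∙ R)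
    adj (wX , wY , m) =
      IsWalk-∙ wX wR , IsWalk-∙ wY wR , map (λ m → Move-++ʳ m (drop 1 R)) (λ m → Move-++ʳ m (drop 1 R)) m

  ∙-congˡ : ∀ {a b c X X' L} → IsWalk H c a L → SameComp H a b X X' →
            SameComp H c b (L ∙ X) (L ∙ X')
  ∙-congˡ {a} {L = L} wL X∼X' with IsWalk-init wL
  ... | P , L≡P++a = gmap (L ∙_) adj X∼X'
    where
    L∙X≡P++X : ∀ {b X} → IsWalk H a b X → L ∙ X ≡ P ++ X
    L∙X≡P++X {X = X} wX = begin
      L ++ drop 1 X            ≡⟨ cong (_++ drop 1 X) L≡P++a ⟩
      (P ++ [ a ]) ++ drop 1 X ≡⟨ ++-assoc P [ a ] (drop 1 X) ⟩
      P ++ (a ∷ drop 1 X)      ≡⟨ cong (P ++_) (sym (IsWalk-head wX)) ⟩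
      P ++ X                   ∎
      where open ≡-Reasoning
    move : ∀ {b X Y} → IsWalk H a b X → IsWalk H a b Y → Move H X Y → Move H (L ∙ X) (L ∙ Y)
    move wX wY m = subst₂ (Move H) (sym (L∙X≡P++X wX)) (sym (L∙X≡P++X wY)) (Move-++ˡ m P)
    adj : ∀ {X Y} → ΠAdj H _ _ X Y → ΠAdj H _ _ (L ∙ X) (L ∙ Y)
    adj (wX , wY , inj₁ m) = IsWalk-∙ wL wX , IsWalk-∙ wL wY , inj₁ (move wX wY m)
    adj (wX , wY , inj₂ m) = IsWalk-∙ wL wX , IsWalk-∙ wL wY , inj₂ (move wY wX m)

  ∙-inverseʳ : ∀ {a b X} → IsWalk H a b X → Contractible H a (X ∙ reverse X)
  ∙-inverseʳ (one x) = ε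
  ∙-inverseʳ (step {x} {y} {l = l} x~y w) = begin
    (x ∷ l) ++ drop 1 (reverse (x ∷ l))    ≡⟨ cong (λ r → x ∷ l ++ drop 1 r) (unfold-reverse x l) ⟩
    x ∷ l ++ drop 1 (reverse l ++ [ x ])   ≡⟨ cong (λ r → x ∷ l ++ r) (drop1-++ (IsWalk-reverse w) [ x ]) ⟩
    x ∷ l ++ (drop 1 (reverse l) ++ [ x ]) ≡⟨ cong (x ∷_) (sym (++-assoc l (drop 1 (reverse l)) [ x ])) ⟩
    bracket (l ∙ reverse l)                ≈⟨ gmap bracket adj (∙-inverseʳ w) ⟩
    x ∷ y ∷ x ∷ []                         ≈⟨ (xyx , xxx , inj₁ (P2 x [] y x x [] x~y)) ◅ ε ⟩
    x ∷ x ∷ x ∷ []                         ≈⟨ (xxx , xx , inj₂ (P1 [] x [ x ])) ◅ ε ⟩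
    x ∷ x ∷ []                             ≈⟨ (xx , one x , inj₂ (P1 [] x [])) ◅ ε ⟩
    x ∷ []                                 ∎
    where
    open SetoidReasoning (Π-setoid x x)
    bracket : List (V H) → List (V H)
    bracket Z = x ∷ (Z ++ [ x ])
    adj : ∀ {X Y} → ΠAdj H y y X Y → ΠAdj H x x (bracket X) (bracket Y)
    adj (wX , wY , m) =
      step x~y (IsWalk-snoc wX (~-sym x~y)) , step x~y (IsWalk-snoc wY (~-sym x~y)) ,
      map (λ m → Move-++ˡ (Move-++ʳ m [ x ]) [ x ]) (λ m → Move-++ˡ (Move-++ʳ m [ x ]) [ x ]) m
    xyx : IsWalk H x x (x ∷ y ∷ x ∷ [])
    xyx = step x~y (step (~-sym x~y) (one x))
    xxx : IsWalk H x x (x ∷ x ∷ x ∷ [])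
    xxx = step (refl~ x) (step (refl~ x) (one x))
    xx : IsWalk H x x (x ∷ x ∷ [])
    xx = step (refl~ x) (one x)

  ∙-inverseˡ : ∀ {a b X} → IsWalk H a b X → Contractible H b (reverse X ∙ X)
  ∙-inverseˡ {X = X} w =
    subst (λ Y → Contractible H _ (reverse X ∙ Y)) (reverse-involutive X) (∙-inverseʳ (IsWalk-reverse w))

  Contractible-∙⇔ : ∀ {x y L M} → IsWalk H x y L → IsWalk H y x M →
                    Contractible H x (L ∙ M) ⇔ SameComp H x y L (reverse M)
  Contractible-∙⇔ {x} {y} {L} {M} wL wM = mk⇔ ⇒ ⇐
    where
    ⇒ : Contractible H x (L ∙ M) → SameComp H x y L (reverse M)
    ⇒ LM∼0 = begin
      L                   ≡⟨ sym (∙-identityʳ L {y}) ⟩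
      L ∙ [ y ]           ≈⟨ ∙-congˡ wL (SameComp-sym (∙-inverseʳ wM)) ⟩
      L ∙ (M ∙ reverse M) ≡⟨ sym (∙-assoc wM L (reverse M)) ⟩
      L ∙ M ∙ reverse M   ≈⟨ ∙-congʳ LM∼0 (IsWalk-reverse wM) ⟩
      [ x ] ∙ reverse M   ≡⟨ ∙-identityˡ (IsWalk-reverse wM) ⟩
      reverse M           ∎
      where open SetoidReasoning (Π-setoid x y)
    ⇐ : SameComp H x y L (reverse M) → Contractible H x (L ∙ M)
    ⇐ L∼M⁻¹ = ∙-congʳ L∼M⁻¹ wM ◅◅ ∙-inverseˡ wM

  Contractible-rotate : ∀ {x y L M} → IsWalk H x y L → IsWalk H y x M →
                        Contractible H x (L ∙ M) → Contractible H y (M ∙ L)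
  Contractible-rotate wL wM LM∼0 =
    ∙-congˡ wM (to (Contractible-∙⇔ wL wM) LM∼0) ◅◅ ∙-inverseʳ wM

  Contractible-rotate⇔ : ∀ {x y L M} → IsWalk H x y L → IsWalk H y x M →
                         Contractible H x (L ∙ M) ⇔ Contractible H y (M ∙ L)
  Contractible-rotate⇔ wL wM = mk⇔ (Contractible-rotate wL wM) (Contractible-rotate wM wL)

  Contractible-∙reverse-∙⇔ : ∀ {t a b Q X P} → IsWalk H t b Q → IsWalk H a b X → IsWalk H a t P →
                             Contractible H t (Q ∙ reverse X ∙ P) ⇔ SameComp H a b (P ∙ Q) X
  Contractible-∙reverse-∙⇔ {a = a} {b} {Q} {X} {P} wQ wX wP =
    ⇔-trans (Contractible-rotate⇔ (IsWalk-∙ wQ wX⁻¹) wP)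
      (subst (λ D → Contractible H a D ⇔ SameComp H a b (P ∙ Q) X) (∙-assoc wQ P (reverse X))
        (subst (λ Y → Contractible H a (P ∙ Q ∙ reverse X) ⇔ SameComp H a b (P ∙ Q) Y) (reverse-involutive X)
          (Contractible-∙⇔ (IsWalk-∙ wP wQ) wX⁻¹)))
    where
    wX⁻¹ : IsWalk H b a (reverse X)
    wX⁻¹ = IsWalk-reverse wX

  unconjugate : ∀ {s a b U W Y} → IsWalk H s a U → IsWalk H b s W → IsWalk H a b Y →
                SameComp H a b (reverse U ∙ (U ∙ Y ∙ W ∙ reverse W)) Y
  unconjugate {a = a} {b} {U} {W} {Y} wU wW wY = begin
    reverse U ∙ (U ∙ Y ∙ W ∙ reverse W)     ≡⟨ cong (reverse U ∙_) (∙-assoc wW (U ∙ Y) (reverse W)) ⟩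
    reverse U ∙ (U ∙ Y ∙ (W ∙ reverse W))   ≡⟨ cong (reverse U ∙_) (∙-assoc wY U (W ∙ reverse W)) ⟩
    reverse U ∙ (U ∙ (Y ∙ (W ∙ reverse W))) ≡⟨ sym (∙-assoc wU (reverse U) (Y ∙ (W ∙ reverse W))) ⟩
    reverse U ∙ U ∙ (Y ∙ (W ∙ reverse W))   ≈⟨ ∙-congʳ (∙-inverseˡ wU) wYWW⁻¹ ⟩
    [ a ] ∙ (Y ∙ (W ∙ reverse W))           ≡⟨ ∙-identityˡ wYWW⁻¹ ⟩
    Y ∙ (W ∙ reverse W)                     ≈⟨ ∙-congˡ wY (∙-inverseʳ wW) ⟩
    Y ∙ [ b ]                               ≡⟨ ∙-identityʳ Y {b} ⟩
    Y                                       ∎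
    where
    open SetoidReasoning (Π-setoid a b)
    wYWW⁻¹ : IsWalk H a b (Y ∙ (W ∙ reverse W))
    wYWW⁻¹ = IsWalk-∙ wY (IsWalk-∙ wW (IsWalk-reverse wW))

  conjugate-cong⇔ : ∀ {s a b U W Y Y'} → IsWalk H s a U → IsWalk H b s W → IsWalk H a b Y → IsWalk H a b Y' →
                    SameComp H s s (U ∙ Y ∙ W) (U ∙ Y' ∙ W) ⇔ SameComp H a b Y Y'
  conjugate-cong⇔ wU wW wY wY' = mk⇔
    (λ c → SameComp-sym (unconjugate wU wW wY)
           ◅◅ ∙-congˡ (IsWalk-reverse wU) (∙-congʳ c (IsWalk-reverse wW))
           ◅◅ unconjugate wU wW wY')
    (λ Y∼Y' → ∙-congʳ (∙-congˡ wU Y∼Y') wW)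

lemma3p8 : (H : RGraph) → TriangleFree H →
    (s t a b : V H) → (U₁ X V₁ U₂ V₂ : List (V H)) →
    IsWalk H s a U₁ → IsWalk H a b X → IsWalk H b s V₁ →
    IsWalk H t b U₂ → IsWalk H a t V₂ →
    let _∙_ = _·_ H
        C₁ = (U₁ ∙ X) ∙ V₁
        C₂ = (U₂ ∙ reverse X) ∙ V₂
        C = ((U₁ ∙ V₂) ∙ U₂) ∙ V₁
    in ((Contractible H s C₁ × Contractible H t C₂)
        ⊎ (Contractible H s C₁ × Contractible H s C)
        ⊎ (Contractible H t C₂ × Contractible H s C)) →
       Contractible H s C₁ × Contractible H t C₂ × Contractible H s C
lemma3p8 H _ s t a b U₁ X V₁ U₂ V₂ wU₁ wX wV₁ wU₂ wV₂ = two-of-three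
  where
  _∙_ : List (V H) → List (V H) → List (V H)
  _∙_ = _·_ H

  C₁ C₂ C : List (V H)
  C₁ = (U₁ ∙ X) ∙ V₁
  C₂ = (U₂ ∙ reverse X) ∙ V₂
  C  = ((U₁ ∙ V₂) ∙ U₂) ∙ V₁

  C₂⇔ : Contractible H t C₂ ⇔ SameComp H a b (V₂ ∙ U₂) X
  C₂⇔ = Contractible-∙reverse-∙⇔ H wU₂ wX wV₂

  C∼C₁⇔ : SameComp H s s C C₁ ⇔ SameComp H a b (V₂ ∙ U₂) X
  C∼C₁⇔ = subst (λ D → SameComp H s s D C₁ ⇔ _) (sym (cong (_∙ V₁) (∙-assoc H wV₂ U₁ U₂)))
                (conjugate-cong⇔ H wU₁ wV₁ (IsWalk-∙ H wV₂ wU₂) wX)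

  C∼C₁ : Contractible H t C₂ → SameComp H s s C C₁
  C∼C₁ c₂ = from C∼C₁⇔ (to C₂⇔ c₂)

  two-of-three : (Contractible H s C₁ × Contractible H t C₂)
                 ⊎ (Contractible H s C₁ × Contractible H s C)
                 ⊎ (Contractible H t C₂ × Contractible H s C) →
                 Contractible H s C₁ × Contractible H t C₂ × Contractible H s C
  two-of-three (inj₁ (c₁ , c₂))        = c₁ , c₂ , C∼C₁ c₂ ◅◅ c₁
  two-of-three (inj₂ (inj₁ (c₁ , c)))  = c₁ , from C₂⇔ (to C∼C₁⇔ (c ◅◅ SameComp-sym H c₁)) , c
  two-of-three (inj₂ (inj₂ (c₂ , c)))  = SameComp-sym H (C∼C₁ c₂) ◅◅ c , c₂ , c
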